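{- Let $a\geq 0$ and $b\geq 0$ be integers such that $b<a+3\leq 2b$, and let $\mathbf{d}=(3,3,2,\ldots,2)\in\mathbb{Z}_+^{a+2}$ (two entries equal to $3$ and $a$ entries equal to $2$) and $\mathbf{t}=(a+3,b,a+3-b)\in\mathbb{Z}_+^3$. Then the pair $(\mathbf{d};\mathbf{t})$ is not realizable, i.e., it is not the degree sequence of any geographic plan.
   Context: Graphs are finite and undirected, with loops and multiple edges allowed; a loop contributes $2$ to the degree of its vertex. A map is an embedding of a connected graph $G=(V,E)$ in a compact surface without boundary such that edges meet only at common endpoints and every connected component of the complement of the image (a country) is homeomorphic to an open disk. The dual graph $G^*$ has the countries as vertices and has the same edge set $E$: each edge $e$ joins the one or two countries on whose boundary it lies. A plan is a pair $(G,H)$ of graphs with a common edge set; it is geographic if there is a map of $G$ such that $H$ is its dual graph $G^*$ (with the given identification of edges). If $G$ has degree sequence $\mathbf{d}$ and $H$ has degree sequence $\mathbf{t}$ (up to ordering), then $(\mathbf{d};\mathbf{t})$ is the degree sequence of the plan. A pair $(\mathbf{d};\mathbf{t})$ is realizable if it is the degree sequence of some geographic plan. -}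

module Defs where

-- Combinatorial encoding of maps on closed (connected, possibly
-- non-orientable) surfaces via flags ("graph-encoded maps" / gems).  Each edge e has four flags (e , i , s):
--   i : Bool  -- which end of the edge (vertex side)
--   s : Bool  -- which side of the edge (country side)
-- λ-move  flips the end   (same side),  μ-move flips the side (same end),
-- ρ-move  is an arbitrary fixed-point-free involution pairing each flag
-- with the neighbouring flag (of another edge-end) around its vertex.
-- Vertices of the map = orbits of ⟨ρ, μ⟩, countries = orbits of ⟨ρ, λ⟩,
-- and the surface is connected iff ⟨λ, μ, ρ⟩ acts transitively.

open import Data.Nat using (ℕ; zero; suc; _+_; _*_; _<_)
open import Data.Bool using (Bool; true; false; not)
open import Data.Fin using (Fin)
open import Data.Fin.Properties using (_≟_)
open import Data.Product using (Σ; _×_; _,_; ∃; ∃-syntax)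
open import Data.Sum using (_⊎_)
open import Data.List using (List; []; _∷_; length; filter; concatMap)
open import Data.List.Base using (allFin)
open import Data.Vec using (Vec; lookup; []; _∷_)
open import Relation.Binary.PropositionalEquality using (_≡_; _≢_)
open import Relation.Binary.Construct.Closure.ReflexiveTransitive using (Star)

Flag : ℕ → Set
Flag m = Fin m × Bool × Bool

flipEnd : ∀ {m} → Flag m → Flag m
flipEnd (e , i , s) = (e , not i , s)

flipSide : ∀ {m} → Flag m → Flag m
flipSide (e , i , s) = (e , i , not s)

data Step {m : ℕ} (ρ : Flag m → Flag m) : Flag m → Flag m → Set where
  byλ : ∀ f → Step ρ f (flipEnd f)
  byμ : ∀ f → Step ρ f (flipSide f)
  byρ : ∀ f → Step ρ f (ρ f)

data VStep {m : ℕ} (ρ : Flag m → Flag m) : Flag m → Flag m → Set where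
  byμ : ∀ f → VStep ρ f (flipSide f)
  byρ : ∀ f → VStep ρ f (ρ f)

data FStep {m : ℕ} (ρ : Flag m → Flag m) : Flag m → Flag m → Set where
  byλ : ∀ f → FStep ρ f (flipEnd f)
  byρ : ∀ f → FStep ρ f (ρ f)

halfEdges : (m : ℕ) → List (Fin m × Bool)
halfEdges m = concatMap (λ e → (e , false) ∷ (e , true) ∷ []) (allFin m)

-- number of edge-ends at vertex v: the degree of v in G (a loop counts 2)
vdeg : ∀ {m n} → (Flag m → Fin n) → Fin n → ℕ
vdeg {m} V v = length (filter (λ p → V (Data.Product.proj₁ p , Data.Product.proj₂ p , false) ≟ v) (halfEdges m))

-- number of edge-sides on country c: the degree of c in G* (an edge with
-- both sides on c is a loop of G* and counts 2)
fdeg : ∀ {m k} → (Flag m → Fin k) → Fin k → ℕ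
fdeg {m} F c = length (filter (λ p → F (Data.Product.proj₁ p , false , Data.Product.proj₂ p) ≟ c) (halfEdges m))

record FlagMap (m n k : ℕ) (d : Vec ℕ n) (t : Vec ℕ k) : Set where
  field
    ρ          : Flag m → Flag m
    ρ-invol    : ∀ f → ρ (ρ f) ≡ f
    ρ-fpf      : ∀ f → ρ f ≢ f
    connected  : ∀ f g → Star (Step ρ) f g
    V          : Flag m → Fin n
    V-ρ        : ∀ f → V (ρ f) ≡ V f
    V-μ        : ∀ f → V (flipSide f) ≡ V f
    V-orbit    : ∀ f g → V f ≡ V g → Star (VStep ρ) f g
    V-onto     : ∀ v → ∃[ f ] V f ≡ v
    V-deg      : ∀ v → vdeg V v ≡ lookup d v
    F          : Flag m → Fin k
    F-ρ        : ∀ f → F (ρ f) ≡ F f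
    F-λ        : ∀ f → F (flipEnd f) ≡ F f
    F-orbit    : ∀ f g → F f ≡ F g → Star (FStep ρ) f g
    F-onto     : ∀ c → ∃[ f ] F f ≡ c
    F-deg      : ∀ c → fdeg F c ≡ lookup t c

-- Either the trivial map (one vertex, no edges, one country: the sphere),
-- or a map with at least one edge encoded by flags.  Degree sequences are
-- taken up to ordering, which is absorbed by the choice of labellings V, F.
Realizable : ∀ {n k} → Vec ℕ n → Vec ℕ k → Set
Realizable {n} {k} d t =
  (Σ (n ≡ 1) (λ { _ → Σ (k ≡ 1) λ { _ → (∀ v → lookup d v ≡ 0) × (∀ c → lookup t c ≡ 0) } }))
  ⊎ (∃[ m ] (0 < m) × FlagMap m n k d t)

dSeq : (a : ℕ) → Vec ℕ (2 + a)
dSeq a = 3 ∷ 3 ∷ Data.Vec.replicate a 2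

tSeq : (a b : ℕ) → Vec ℕ 3
tSeq a b = (a + 3) ∷ b ∷ (a + 3 Data.Nat.∸ b) ∷ []

{-# OPTIONS --safe #-}

-- By the handshake lemma the map has m = a + 3 edges, so the country A of degree a + 3 has as
-- many sides as there are edges. Let s(e) ∈ {0, 1, 2} count the sides of the edge e lying on A;
-- then Σₑ s(e) = m, so either s ≡ 1 or s takes both values 0 and 2. The two ends at a vertex of
-- degree 2 see the same two corners, so s is constant along chains of such vertices, and every
-- value of s already occurs at one of the six edge-ends of the two trivalent vertices. If the
-- corners of a trivalent vertex lie in A according to the bits i, j, k, its ends carry
-- i + j, i + k, j + k: these are never all 1, and they contain an odd number of 2s exactly when
-- they contain a 2, in which case they contain no 0. Since every edge has two ends and every
-- vertex of degree 2 carries its 2s in pairs, the two trivalent vertices carry an even number of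
-- 2s in total; so either neither carries a 2 or neither carries a 0, although both values occur.

module Submission where

open import Defs
open import Data.Nat using (ℕ; zero; suc; _+_; _*_; _<_; _≤_; z≤n; s≤s)
open import Data.Nat.Properties
open import Algebra.Properties.CommutativeSemigroup +-commutativeSemigroup using (interchange)
open import Algebra.Properties.Semiring.Sum +-*-semiring
  using (sum; sum-syntax; sum-cong-≗; sum-replicate-zero; ∑-distrib-+; ∑-comm; *-distribʳ-sum)
open import Data.Bool using (Bool; true; false; not)
open import Data.Bool.Properties using (not-involutive) renaming (_≟_ to _≟ᵇ_)
open import Data.Empty using (⊥)
open import Data.Fin using (Fin; zero; suc)
open import Data.Fin.Properties using (any?) renaming (_≟_ to _≟ᶠ_)
open import Data.List using (List; []; _∷_; _++_; length; filter; concatMap; tabulate; map)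
open import Data.List.Properties using (map-∘)
open import Data.List.Membership.Propositional using (_∈_; _∉_)
open import Data.List.Membership.Propositional.Properties using (∈-map⁺; ∈-++⁺ˡ; ∈-++⁺ʳ; ∈-++⁻)
open import Data.List.Membership.DecPropositional Data.Nat._≟_ using (_∈?_)
open import Data.List.Relation.Unary.All as All using (All; []; _∷_)
open import Data.List.Relation.Unary.All.Properties using (map⁺)
open import Data.List.Relation.Unary.Any as Any using (here; there)
open import Data.List.Relation.Unary.Unique.Propositional using (Unique; []; _∷_)
open import Data.Nat.Divisibility using (_∣_; _∣?_; divides; ∣m∣n⇒∣m+n; ∣m+n∣m⇒∣n)
open import Data.Nat.ListAction using () renaming (sum to sumˡ)
open import Data.Nat.Tactic.RingSolver using (solve-∀)
open import Data.Product using (∃-syntax; _×_; _,_; proj₁; proj₂)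
open import Data.Product.Properties using (≡-dec)
open import Data.Sum as Sum using (_⊎_; inj₁; inj₂; [_,_]′)
open import Data.Vec using (Vec; lookup; replicate)
open import Data.Vec.Properties using (lookup-replicate)
open import Function using (_∘_)
open import Relation.Binary using (Rel)
open import Relation.Binary.Construct.Closure.ReflexiveTransitive using (Star; ε; _◅_)
open import Relation.Binary.PropositionalEquality
open import Relation.Nullary using (¬_; Dec; yes; no; does; contradiction; ¬?; _×-dec_; _⊎-dec_)
open import Relation.Nullary.Decidable using (from-yes; from-no)
open import Relation.Unary using (Decidable)

bit : Bool → ℕ
bit true  = 1
bit false = 0

𝟙 : ∀ {p} {P : Set p} → Dec P → ℕ
𝟙 d = bit (does d)

module _ {p} {P : Set p} where

  𝟙-yes : (d : Dec P) → P → 𝟙 d ≡ 1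
  𝟙-yes (yes _) _  = refl
  𝟙-yes (no ¬x) x = contradiction x ¬x

  𝟙-no : (d : Dec P) → ¬ P → 𝟙 d ≡ 0
  𝟙-no (yes x) ¬x = contradiction x ¬x
  𝟙-no (no _)  _  = refl

  𝟙≤1 : (d : Dec P) → 𝟙 d ≤ 1
  𝟙≤1 (yes _) = s≤s z≤n
  𝟙≤1 (no _)  = z≤n

sum-const : ∀ n c → ∑[ i < n ] c ≡ n * c
sum-const zero    c = refl
sum-const (suc n) c = cong (c +_) (sum-const n c)

sum-ones : ∀ n → ∑[ i < n ] 1 ≡ n
sum-ones n = trans (sum-const n 1) (*-identityʳ n)

sum-mono-≤ : ∀ {n} {f g : Fin n → ℕ} → (∀ i → f i ≤ g i) → sum f ≤ sum g
sum-mono-≤ {zero}  f≤g = z≤n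
sum-mono-≤ {suc n} f≤g = +-mono-≤ (f≤g zero) (sum-mono-≤ (f≤g ∘ suc))

sum-mono-≤-≡⇒≗ : ∀ {n} {f g : Fin n → ℕ} → (∀ i → f i ≤ g i) → sum f ≡ sum g →
                 ∀ i → f i ≡ g i
sum-mono-≤-≡⇒≗ {suc n} {f} {g} f≤g eq = λ where
    zero    → head≡
    (suc i) → sum-mono-≤-≡⇒≗ (f≤g ∘ suc) tail≡ i
  where
  head≡ : f zero ≡ g zero
  head≡ = ≤-antisym (f≤g zero) (+-cancelʳ-≤ (sum (g ∘ suc)) (g zero) (f zero)
            (≤-trans (≤-reflexive (sym eq)) (+-monoʳ-≤ (f zero) (sum-mono-≤ (f≤g ∘ suc)))))
  tail≡ : sum (f ∘ suc) ≡ sum (g ∘ suc)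
  tail≡ = +-cancelˡ-≡ (f zero) _ _ (trans eq (cong (_+ sum (g ∘ suc)) (sym head≡)))

∣-sum : ∀ {d n} {f : Fin n → ℕ} → (∀ i → d ∣ f i) → d ∣ sum f
∣-sum {n = zero}  _   = divides 0 refl
∣-sum {n = suc n} d∣f = ∣m∣n⇒∣m+n (d∣f zero) (∣-sum (d∣f ∘ suc))

2∣n+n : ∀ n → 2 ∣ n + n
2∣n+n n = divides n (trans (cong (n +_) (sym (+-identityʳ n))) (*-comm 2 n))

∑-δ : ∀ {n} (j : Fin n) → ∑[ i < n ] 𝟙 (j ≟ᶠ i) ≡ 1
∑-δ {suc n} zero    = cong suc (sum-replicate-zero n)
∑-δ {suc n} (suc j) = ∑-δ j

∑-δ-* : ∀ {n} (j : Fin n) c → ∑[ i < n ] (𝟙 (j ≟ᶠ i) * c) ≡ c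
∑-δ-* {n} j c = begin
  ∑[ i < n ] (𝟙 (j ≟ᶠ i) * c)  ≡⟨ *-distribʳ-sum c (λ i → 𝟙 (j ≟ᶠ i)) ⟨
  (∑[ i < n ] 𝟙 (j ≟ᶠ i)) * c  ≡⟨ cong (_* c) (∑-δ j) ⟩
  1 * c                        ≡⟨ *-identityˡ c ⟩
  c                            ∎
  where open ≡-Reasoning

all-one-or-zero-and-two : ∀ {n} (f : Fin n → ℕ) → (∀ i → f i ≤ 2) → sum f ≡ n →
                          (∀ i → f i ≡ 1) ⊎ ((∃[ i ] f i ≡ 0) × (∃[ i ] f i ≡ 2))
all-one-or-zero-and-two {n} f f≤2 sum≡n with any? (λ i → f i ≟ 0) | any? (λ i → f i ≟ 2)
... | yes zero-at | yes two-at = inj₂ (zero-at , two-at)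
... | no no-zero  | _          = inj₁ (λ i → sym (sum-mono-≤-≡⇒≗ 1≤f (trans (sum-ones n) (sym sum≡n)) i))
  where
  1≤f : ∀ i → 1 ≤ f i
  1≤f i = n≢0⇒n>0 (no-zero ∘ (i ,_))
... | yes _       | no no-two  = inj₁ (sum-mono-≤-≡⇒≗ f≤1 (trans sum≡n (sym (sum-ones n))))
  where
  f≤1 : ∀ i → f i ≤ 1
  f≤1 i = ≤-pred (≤∧≢⇒< (f≤2 i) (no-two ∘ (i ,_)))

first-hit : ∀ {a ℓ b} {A : Set a} {R : Rel A ℓ} {B : Set b} (D : A → Set) (I : A → B) →
            (∀ x → D x ⊎ (∀ {y} → R x y → I y ≡ I x)) →
            ∀ {x y} → Star R x y → D y → ∃[ z ] D z × I z ≡ I x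
first-hit D I classify {x} ε         Dy = x , Dy , refl
first-hit D I classify {x} (r ◅ rs)  Dy with classify x
... | inj₁ Dx        = x , Dx , refl
... | inj₂ invariant with first-hit D I classify rs Dy
...   | z , Dz , Iz≡ = z , Dz , trans Iz≡ (invariant r)

pairSums : ℕ → ℕ → ℕ → List ℕ
pairSums i j k = i + j ∷ i + k ∷ j + k ∷ []

pairSums-not-all-one : ∀ i j k → ¬ All (_≡ 1) (pairSums i j k)
pairSums-not-all-one i j k (i+j≡1 ∷ i+k≡1 ∷ j+k≡1 ∷ []) = from-no (2 ∣? 3) (divides (i + j + k) 3≡)
  where
  3≡ : 3 ≡ (i + j + k) * 2
  3≡ = begin
    3                                ≡⟨ cong₂ (λ x y → x + (y + 1)) i+j≡1 i+k≡1 ⟨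
    (i + j) + ((i + k) + 1)          ≡⟨ cong (λ x → (i + j) + ((i + k) + x)) j+k≡1 ⟨
    (i + j) + ((i + k) + (j + k))    ≡⟨ sum-of-pairSums i j k ⟩
    (i + j + k) * 2                  ∎
    where
    open ≡-Reasoning
    sum-of-pairSums : ∀ i j k → (i + j) + ((i + k) + (j + k)) ≡ (i + j + k) * 2
    sum-of-pairSums = solve-∀

twos : List ℕ → ℕ
twos S = sumˡ (map (λ x → 𝟙 (x ≟ 2)) S)

TwosParity : List ℕ → Set
TwosParity S = (2 ∣ twos S × 2 ∉ S) ⊎ (¬ 2 ∣ twos S × 0 ∉ S)

twosParity? : ∀ S → Dec (TwosParity S)
twosParity? S = (2 ∣? twos S ×-dec ¬? (2 ∈? S)) ⊎-dec (¬? (2 ∣? twos S) ×-dec ¬? (0 ∈? S))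

twos-parity : ∀ b₁ b₂ b₃ → TwosParity (pairSums (bit b₁) (bit b₂) (bit b₃))
twos-parity false false false = from-yes (twosParity? (0 ∷ 0 ∷ 0 ∷ []))
twos-parity false false true  = from-yes (twosParity? (0 ∷ 1 ∷ 1 ∷ []))
twos-parity false true  false = from-yes (twosParity? (1 ∷ 0 ∷ 1 ∷ []))
twos-parity false true  true  = from-yes (twosParity? (1 ∷ 1 ∷ 2 ∷ []))
twos-parity true  false false = from-yes (twosParity? (1 ∷ 1 ∷ 0 ∷ []))
twos-parity true  false true  = from-yes (twosParity? (1 ∷ 2 ∷ 1 ∷ []))
twos-parity true  true  false = from-yes (twosParity? (2 ∷ 1 ∷ 1 ∷ []))
twos-parity true  true  true  = from-yes (twosParity? (2 ∷ 2 ∷ 2 ∷ []))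

zero-and-two-excluded : ∀ {S T} → TwosParity S → TwosParity T → 2 ∣ twos S + twos T →
                        0 ∈ S ++ T → 2 ∈ S ++ T → ⊥
zero-and-two-excluded {S} (inj₁ (_ , 2∉S)) (inj₁ (_ , 2∉T)) _ _ 2∈ = [ 2∉S , 2∉T ]′ (∈-++⁻ S 2∈)
zero-and-two-excluded {S} (inj₂ (_ , 0∉S)) (inj₂ (_ , 0∉T)) _ 0∈ _ = [ 0∉S , 0∉T ]′ (∈-++⁻ S 0∈)
zero-and-two-excluded (inj₁ (2∣S , _)) (inj₂ (2∤T , _)) 2∣S+T _ _ = 2∤T (∣m+n∣m⇒∣n 2∣S+T 2∣S)
zero-and-two-excluded {S} {T} (inj₂ (2∤S , _)) (inj₁ (2∣T , _)) 2∣S+T _ _ =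
  2∤S (∣m+n∣m⇒∣n (subst (2 ∣_) (+-comm (twos S) (twos T)) 2∣S+T) 2∣T)

End : ℕ → Set
End m = Fin m × Bool

endOf : ∀ {m} → Flag m → End m
endOf f = proj₁ f , proj₁ (proj₂ f)

flagAt : ∀ {m} → End m → Flag m
flagAt p = proj₁ p , proj₂ p , false

_≟ᴱ_ : ∀ {m} (p q : End m) → Dec (p ≡ q)
_≟ᴱ_ = ≡-dec _≟ᶠ_ _≟ᵇ_

Σᴱ : ∀ {m} → (End m → ℕ) → ℕ
Σᴱ {m} g = ∑[ e < m ] (g (e , false) + g (e , true))

Σᴱ-cong : ∀ {m} {f g : End m → ℕ} → (∀ p → f p ≡ g p) → Σᴱ f ≡ Σᴱ g
Σᴱ-cong {m} f≗g = sum-cong-≗ {m} (λ e → cong₂ _+_ (f≗g _) (f≗g _))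

Σᴱ-mono-≤ : ∀ {m} {f g : End m → ℕ} → (∀ p → f p ≤ g p) → Σᴱ f ≤ Σᴱ g
Σᴱ-mono-≤ {m} f≤g = sum-mono-≤ {m} (λ e → +-mono-≤ (f≤g _) (f≤g _))

Σᴱ-+ : ∀ {m} (f g : End m → ℕ) → Σᴱ (λ p → f p + g p) ≡ Σᴱ f + Σᴱ g
Σᴱ-+ {m} f g =
  trans (sum-cong-≗ {m} (λ e → interchange (f (e , false)) (g (e , false)) (f (e , true)) (g (e , true))))
        (∑-distrib-+ {m} (λ e → f (e , false) + f (e , true)) (λ e → g (e , false) + g (e , true)))

Σᴱ-δ : ∀ {m} (x : End m) (g : End m → ℕ) → Σᴱ (λ p → 𝟙 (x ≟ᴱ p) * g p) ≡ g x
Σᴱ-δ {m} (e₀ , b₀) g = begin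
  Σᴱ (λ p → 𝟙 ((e₀ , b₀) ≟ᴱ p) * g p)  ≡⟨ sum-cong-≗ (at-edge b₀) ⟩
  ∑[ e < m ] (𝟙 (e₀ ≟ᶠ e) * g (e₀ , b₀))  ≡⟨ ∑-δ-* e₀ (g (e₀ , b₀)) ⟩
  g (e₀ , b₀)                             ∎
  where
  open ≡-Reasoning
  at-edge : ∀ b e → 𝟙 ((e₀ , b) ≟ᴱ (e , false)) * g (e , false)
                    + 𝟙 ((e₀ , b) ≟ᴱ (e , true)) * g (e , true)
                  ≡ 𝟙 (e₀ ≟ᶠ e) * g (e₀ , b)
  at-edge b     e with e₀ ≟ᶠ e
  at-edge _     e | no _     = refl
  at-edge false e | yes refl = +-identityʳ _
  at-edge true  e | yes refl = refl

multiplicity : ∀ {m} → List (End m) → End m → ℕ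
multiplicity []       p = 0
multiplicity (x ∷ xs) p = 𝟙 (x ≟ᴱ p) + multiplicity xs p

Σᴱ-multiplicity : ∀ {m} (xs : List (End m)) (g : End m → ℕ) →
                  Σᴱ (λ p → multiplicity xs p * g p) ≡ sumˡ (map g xs)
Σᴱ-multiplicity {m} []       g = sum-replicate-zero m
Σᴱ-multiplicity     (x ∷ xs) g = begin
  Σᴱ (λ p → (𝟙 (x ≟ᴱ p) + multiplicity xs p) * g p)
    ≡⟨ Σᴱ-cong (λ p → *-distribʳ-+ (g p) (𝟙 (x ≟ᴱ p)) (multiplicity xs p)) ⟩
  Σᴱ (λ p → 𝟙 (x ≟ᴱ p) * g p + multiplicity xs p * g p)
    ≡⟨ Σᴱ-+ (λ p → 𝟙 (x ≟ᴱ p) * g p) (λ p → multiplicity xs p * g p) ⟩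
  Σᴱ (λ p → 𝟙 (x ≟ᴱ p) * g p) + Σᴱ (λ p → multiplicity xs p * g p)
    ≡⟨ cong₂ _+_ (Σᴱ-δ x g) (Σᴱ-multiplicity xs g) ⟩
  g x + sumˡ (map g xs) ∎
  where open ≡-Reasoning

Σᴱ-multiplicity-length : ∀ {m} (xs : List (End m)) → Σᴱ (multiplicity xs) ≡ length xs
Σᴱ-multiplicity-length xs = begin
  Σᴱ (multiplicity xs)                  ≡⟨ Σᴱ-cong (λ p → *-identityʳ (multiplicity xs p)) ⟨
  Σᴱ (λ p → multiplicity xs p * 1)      ≡⟨ Σᴱ-multiplicity xs (λ _ → 1) ⟩
  sumˡ (map (λ _ → 1) xs)               ≡⟨ sumˡ-ones xs ⟩
  length xs                             ∎
  where
  open ≡-Reasoning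
  sumˡ-ones : ∀ {A : Set} (xs : List A) → sumˡ (map (λ _ → 1) xs) ≡ length xs
  sumˡ-ones []       = refl
  sumˡ-ones (_ ∷ xs) = cong suc (sumˡ-ones xs)

multiplicity-∈ : ∀ {m} {p : End m} {xs} → p ∈ xs → 1 ≤ multiplicity xs p
multiplicity-∈ {p = p} {x ∷ _} (here p≡x) =
  ≤-trans (≤-reflexive (sym (𝟙-yes (x ≟ᴱ p) (sym p≡x)))) (m≤m+n _ _)
multiplicity-∈ {p = p} {x ∷ _} (there p∈) = ≤-trans (multiplicity-∈ p∈) (m≤n+m _ _)

multiplicity-∉ : ∀ {m} {p : End m} {xs} → p ∉ xs → multiplicity xs p ≡ 0
multiplicity-∉ {xs = []}     _   = refl
multiplicity-∉ {p = p} {x ∷ _} p∉ =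
  cong₂ _+_ (𝟙-no (x ≟ᴱ p) (p∉ ∘ here ∘ sym)) (multiplicity-∉ (p∉ ∘ there))

multiplicity-unique : ∀ {m} {p : End m} {xs} → Unique xs → p ∈ xs → multiplicity xs p ≡ 1
multiplicity-unique {p = p} (x≢ ∷ _) (here refl) =
  cong₂ _+_ (𝟙-yes (p ≟ᴱ p) refl) (multiplicity-∉ (λ p∈ → All.lookup x≢ p∈ refl))
multiplicity-unique {p = p} {x ∷ _} (x≢ ∷ u) (there p∈) =
  cong₂ _+_ (𝟙-no (x ≟ᴱ p) (λ { refl → All.lookup x≢ p∈ refl })) (multiplicity-unique u p∈)

module _ {a p} {A : Set a} {P : A → Set p} (P? : Decidable P) where

  length-filter-∷ : ∀ x xs → length (filter P? (x ∷ xs)) ≡ 𝟙 (P? x) + length (filter P? xs)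
  length-filter-∷ x xs with does (P? x)
  ... | true  = refl
  ... | false = refl

length-filter-halfEdges : ∀ {m p} {P : End m → Set p} (P? : Decidable P) →
                          length (filter P? (halfEdges m)) ≡ Σᴱ (λ q → 𝟙 (P? q))
length-filter-halfEdges {m} P? = tabulated (λ e → e)
  where
  tabulated : ∀ {n} (ι : Fin n → Fin m) →
              length (filter P? (concatMap (λ e → (e , false) ∷ (e , true) ∷ []) (tabulate ι)))
                ≡ ∑[ i < n ] (𝟙 (P? (ι i , false)) + 𝟙 (P? (ι i , true)))
  tabulated {zero}  ι = refl
  tabulated {suc n} ι = begin
    length (filter P? ((ι zero , false) ∷ (ι zero , true) ∷ rest))
      ≡⟨ length-filter-∷ P? _ _ ⟩
    𝟙 (P? (ι zero , false)) + length (filter P? ((ι zero , true) ∷ rest))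
      ≡⟨ cong (_ +_) (length-filter-∷ P? _ _) ⟩
    𝟙 (P? (ι zero , false)) + (𝟙 (P? (ι zero , true)) + length (filter P? rest))
      ≡⟨ +-assoc (𝟙 (P? (ι zero , false))) (𝟙 (P? (ι zero , true))) _ ⟨
    𝟙 (P? (ι zero , false)) + 𝟙 (P? (ι zero , true)) + length (filter P? rest)
      ≡⟨ cong (_ +_) (tabulated (ι ∘ suc)) ⟩
    ∑[ i < suc n ] (𝟙 (P? (ι i , false)) + 𝟙 (P? (ι i , true))) ∎
    where
    open ≡-Reasoning
    rest = concatMap (λ e → (e , false) ∷ (e , true) ∷ []) (tabulate (ι ∘ suc))

flipSide-involutive : ∀ {m} (f : Flag m) → flipSide (flipSide f) ≡ f
flipSide-involutive (e , i , s) = cong (λ s′ → e , i , s′) (not-involutive s)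

flipSide-injective : ∀ {m} {f g : Flag m} → flipSide f ≡ flipSide g → f ≡ g
flipSide-injective {f = f} {g} eq =
  trans (sym (flipSide-involutive f)) (trans (cong flipSide eq) (flipSide-involutive g))

flipSide≢ : ∀ {m} (f : Flag m) → flipSide f ≢ f
flipSide≢ (e , i , false) ()
flipSide≢ (e , i , true)  ()

same-end : ∀ {m} (g f : Flag m) → endOf g ≡ endOf f → g ≡ f ⊎ g ≡ flipSide f
same-end (e , i , false) (.e , .i , false) refl = inj₁ refl
same-end (e , i , true)  (.e , .i , false) refl = inj₂ refl
same-end (e , i , false) (.e , .i , true)  refl = inj₂ refl
same-end (e , i , true)  (.e , .i , true)  refl = inj₁ refl

module MapProperties {m n k} {d : Vec ℕ n} {t : Vec ℕ k} (M : FlagMap m n k d t) where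
  open FlagMap M

  vertex : End m → Fin n
  vertex p = V (flagAt p)

  vertex-endOf : ∀ f → vertex (endOf f) ≡ V f
  vertex-endOf (e , i , false) = refl
  vertex-endOf (e , i , true)  = V-μ (e , i , true)

  ρ-injective : ∀ {f g} → ρ f ≡ ρ g → f ≡ g
  ρ-injective {f} {g} eq = trans (sym (ρ-invol f)) (trans (cong ρ eq) (ρ-invol g))

  count : Fin n → (End m → ℕ) → ℕ
  count w g = Σᴱ (λ p → 𝟙 (vertex p ≟ᶠ w) * g p)

  vdeg≡Σᴱ : ∀ w → vdeg V w ≡ Σᴱ (λ p → 𝟙 (vertex p ≟ᶠ w))
  vdeg≡Σᴱ w = length-filter-halfEdges (λ p → vertex p ≟ᶠ w)

  ∑-count : ∀ g → ∑[ w < n ] count w g ≡ Σᴱ g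
  ∑-count g = begin
    ∑[ w < n ] ∑[ e < m ] (δ w (e , false) + δ w (e , true))
      ≡⟨ ∑-comm (λ w e → δ w (e , false) + δ w (e , true)) ⟩
    ∑[ e < m ] ∑[ w < n ] (δ w (e , false) + δ w (e , true))
      ≡⟨ sum-cong-≗ {m} (λ e → ∑-distrib-+ {n} (λ w → δ w (e , false)) (λ w → δ w (e , true))) ⟩
    ∑[ e < m ] (∑[ w < n ] δ w (e , false) + ∑[ w < n ] δ w (e , true))
      ≡⟨ sum-cong-≗ {m} (λ e → cong₂ _+_ (∑-δ-* (vertex (e , false)) _)
                                          (∑-δ-* (vertex (e , true)) _)) ⟩
    Σᴱ g ∎
    where
    open ≡-Reasoning
    δ : Fin n → End m → ℕ
    δ w p = 𝟙 (vertex p ≟ᶠ w) * g p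

  handshake : ∑[ w < n ] lookup d w ≡ m * 2
  handshake = begin
    ∑[ w < n ] lookup d w
      ≡⟨ sum-cong-≗ {n} (λ w → trans (sym (V-deg w)) (vdeg≡Σᴱ w)) ⟩
    ∑[ w < n ] Σᴱ (λ p → 𝟙 (vertex p ≟ᶠ w))
      ≡⟨ sum-cong-≗ {n} (λ w → Σᴱ-cong (λ p → sym (*-identityʳ (𝟙 (vertex p ≟ᶠ w))))) ⟩
    ∑[ w < n ] count w (λ _ → 1)
      ≡⟨ ∑-count (λ _ → 1) ⟩
    ∑[ e < m ] 2
      ≡⟨ sum-const m 2 ⟩
    m * 2 ∎
    where open ≡-Reasoning

  Covers : Fin n → List (End m) → Set
  Covers w xs = ∀ p → vertex p ≡ w → p ∈ xs

  vdeg≤length : ∀ {w xs} → Covers w xs → vdeg V w ≤ length xs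
  vdeg≤length {w} {xs} cov = begin
    vdeg V w                            ≡⟨ vdeg≡Σᴱ w ⟩
    Σᴱ (λ p → 𝟙 (vertex p ≟ᶠ w))        ≤⟨ Σᴱ-mono-≤ at≤ ⟩
    Σᴱ (multiplicity xs)                ≡⟨ Σᴱ-multiplicity-length xs ⟩
    length xs                           ∎
    where
    open ≤-Reasoning
    at≤ : ∀ p → 𝟙 (vertex p ≟ᶠ w) ≤ multiplicity xs p
    at≤ p with vertex p ≟ᶠ w
    ... | yes at = multiplicity-∈ (cov p at)
    ... | no _   = z≤n

  length≤vdeg : ∀ {w xs} → Unique xs → All (λ p → vertex p ≡ w) xs → length xs ≤ vdeg V w
  length≤vdeg {w} {xs} uniq at = begin
    length xs                           ≡⟨ Σᴱ-multiplicity-length xs ⟨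
    Σᴱ (multiplicity xs)                ≤⟨ Σᴱ-mono-≤ ≤at ⟩
    Σᴱ (λ p → 𝟙 (vertex p ≟ᶠ w))        ≡⟨ vdeg≡Σᴱ w ⟨
    vdeg V w                            ∎
    where
    open ≤-Reasoning
    ≤at : ∀ p → multiplicity xs p ≤ 𝟙 (vertex p ≟ᶠ w)
    ≤at p with Any.any? (p ≟ᴱ_) xs
    ... | yes p∈ = ≤-reflexive (trans (multiplicity-unique uniq p∈)
                                      (sym (𝟙-yes (vertex p ≟ᶠ w) (All.lookup at p∈))))
    ... | no p∉  = ≤-trans (≤-reflexive (multiplicity-∉ p∉)) z≤n

  record EndsAt (w : Fin n) (xs : List (End m)) : Set where
    field
      unique : Unique xs
      at     : All (λ p → vertex p ≡ w) xs
      covers : Covers w xs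

  count-EndsAt : ∀ {w xs} → EndsAt w xs → ∀ g → count w g ≡ sumˡ (map g xs)
  count-EndsAt {w} {xs} ends g = trans (Σᴱ-cong at≡) (Σᴱ-multiplicity xs g)
    where
    open EndsAt ends
    at≡ : ∀ p → 𝟙 (vertex p ≟ᶠ w) * g p ≡ multiplicity xs p * g p
    at≡ p with vertex p ≟ᶠ w
    ... | yes at-p = cong (_* g p) (sym (multiplicity-unique unique (covers p at-p)))
    ... | no ¬at-p = cong (_* g p) (sym (multiplicity-∉ (¬at-p ∘ All.lookup at)))

  EndsAt-of-length : ∀ {w xs} → Unique xs → All (λ p → vertex p ≡ w) xs → length xs ≡ vdeg V w →
                     EndsAt w xs
  EndsAt-of-length {w} {xs} uniq at len = record { unique = uniq ; at = at ; covers = covers }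
    where
    covers : Covers w xs
    covers p at-p with Any.any? (p ≟ᴱ_) xs
    ... | yes p∈ = p∈
    ... | no p∉  = contradiction (length≤vdeg (p∉xs ∷ uniq) (at-p ∷ at)) (<-irrefl len)
      where
      p∉xs : All (p ≢_) xs
      p∉xs = All.tabulate (λ x∈ p≡x → p∉ (subst (_∈ xs) (sym p≡x) x∈))

  vdeg≤ρ-closed : ∀ xs f → endOf f ∈ xs → (∀ g → endOf g ∈ xs → endOf (ρ g) ∈ xs) →
                  vdeg V (V f) ≤ length xs
  vdeg≤ρ-closed xs f f∈ closed = vdeg≤length covers
    where
    along : ∀ {g h} → Star (VStep ρ) g h → endOf g ∈ xs → endOf h ∈ xs
    along ε               g∈ = g∈
    along (byμ g ◅ steps) g∈ = along steps g∈
    along (byρ g ◅ steps) g∈ = along steps (closed g g∈)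
    covers : Covers (V f) xs
    covers p at-p = along (V-orbit f (flagAt p) (sym at-p)) f∈

  ρ≢flipSide : ∀ {f} → 2 ≤ vdeg V (V f) → ρ f ≢ flipSide f
  ρ≢flipSide {f} 2≤deg ρf≡μf = <⇒≱ 2≤deg (vdeg≤ρ-closed (endOf f ∷ []) f (here refl) closed)
    where
    closed : ∀ g → endOf g ∈ endOf f ∷ [] → endOf (ρ g) ∈ endOf f ∷ []
    closed g (here eq) with same-end g f eq
    ... | inj₁ refl = here (cong endOf ρf≡μf)
    ... | inj₂ refl = here (cong endOf (trans (cong ρ (sym ρf≡μf)) (ρ-invol f)))

  endOf-ρ≢ : ∀ {f} → 2 ≤ vdeg V (V f) → endOf (ρ f) ≢ endOf f
  endOf-ρ≢ {f} 2≤deg eq with same-end (ρ f) f eq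
  ... | inj₁ ρf≡f  = ρ-fpf _ ρf≡f
  ... | inj₂ ρf≡μf = ρ≢flipSide 2≤deg ρf≡μf

  ρ∘flipSide≢flipSide∘ρ : ∀ {f} → 3 ≤ vdeg V (V f) → ρ (flipSide f) ≢ flipSide (ρ f)
  ρ∘flipSide≢flipSide∘ρ {f} 3≤deg comm = <⇒≱ 3≤deg (vdeg≤ρ-closed xy f (here refl) closed)
    where
    xy = endOf f ∷ endOf (ρ f) ∷ []
    closed : ∀ g → endOf g ∈ xy → endOf (ρ g) ∈ xy
    closed g (here eq) with same-end g f eq
    ... | inj₁ refl = there (here refl)
    ... | inj₂ refl = there (here (cong endOf comm))
    closed g (there (here eq)) with same-end g (ρ f) eq
    ... | inj₁ refl = here (cong endOf (ρ-invol f))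
    ... | inj₂ refl = here (cong endOf (trans (cong ρ (sym comm)) (ρ-invol (flipSide f))))

  degree-two : ∀ {f} → vdeg V (V f) ≡ 2 →
               EndsAt (V f) (endOf f ∷ endOf (ρ f) ∷ []) × ρ (flipSide f) ≡ flipSide (ρ f)
  degree-two {f} deg≡2 = ends , comm
    where
    2≤deg = ≤-reflexive (sym deg≡2)
    ends : EndsAt (V f) (endOf f ∷ endOf (ρ f) ∷ [])
    ends = EndsAt-of-length ((endOf-ρ≢ 2≤deg ∘ sym ∷ []) ∷ [] ∷ [])
                            (vertex-endOf f ∷ trans (vertex-endOf (ρ f)) (V-ρ f) ∷ [])
                            (sym deg≡2)
    comm : ρ (flipSide f) ≡ flipSide (ρ f)
    comm with EndsAt.covers ends _ (trans (vertex-endOf _) (trans (V-ρ _) (V-μ f)))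
    ... | here eq with same-end (ρ (flipSide f)) f eq
    ...   | inj₁ ρμf≡f  = contradiction (trans (cong ρ (sym ρμf≡f)) (ρ-invol _)) (ρ≢flipSide 2≤deg)
    ...   | inj₂ ρμf≡μf = contradiction ρμf≡μf (ρ-fpf _)
    comm | there (here eq) with same-end (ρ (flipSide f)) (ρ f) eq
    ...   | inj₁ ρμf≡ρf = contradiction (ρ-injective ρμf≡ρf) (flipSide≢ f)
    ...   | inj₂ ρμf≡μρf = ρμf≡μρf

  -- The flags around a trivalent vertex are f, ρ f, μ ρ f, ρ μ ρ f = μ ρ μ f, ρ μ f, μ f.
  degree-three : ∀ {f} → vdeg V (V f) ≡ 3 →
                 EndsAt (V f) (endOf f ∷ endOf (ρ f) ∷ endOf (ρ (flipSide f)) ∷ [])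
                 × ρ (flipSide (ρ f)) ≡ flipSide (ρ (flipSide f))
  degree-three {f} deg≡3 = ends , hexagon
    where
    3≤deg = ≤-reflexive (sym deg≡3)
    2≤deg = ≤-trans (n≤1+n 2) 3≤deg
    x≢y : endOf f ≢ endOf (ρ f)
    x≢y = endOf-ρ≢ 2≤deg ∘ sym
    x≢z : endOf f ≢ endOf (ρ (flipSide f))
    x≢z eq with same-end (ρ (flipSide f)) f (sym eq)
    ... | inj₁ ρμf≡f  = ρ≢flipSide 2≤deg (trans (cong ρ (sym ρμf≡f)) (ρ-invol _))
    ... | inj₂ ρμf≡μf = ρ-fpf _ ρμf≡μf
    y≢z : endOf (ρ f) ≢ endOf (ρ (flipSide f))
    y≢z eq with same-end (ρ (flipSide f)) (ρ f) (sym eq)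
    ... | inj₁ ρμf≡ρf  = flipSide≢ f (ρ-injective ρμf≡ρf)
    ... | inj₂ ρμf≡μρf = ρ∘flipSide≢flipSide∘ρ 3≤deg ρμf≡μρf
    ends : EndsAt (V f) (endOf f ∷ endOf (ρ f) ∷ endOf (ρ (flipSide f)) ∷ [])
    ends = EndsAt-of-length ((x≢y ∷ x≢z ∷ []) ∷ (y≢z ∷ []) ∷ [] ∷ [])
                            (vertex-endOf f ∷ trans (vertex-endOf (ρ f)) (V-ρ f)
                              ∷ trans (vertex-endOf _) (trans (V-ρ _) (V-μ f)) ∷ [])
                            (sym deg≡3)
    hexagon : ρ (flipSide (ρ f)) ≡ flipSide (ρ (flipSide f))
    hexagon with EndsAt.covers ends _ (trans (vertex-endOf _) (trans (V-ρ _) (trans (V-μ _) (V-ρ f))))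
    ... | here eq with same-end (ρ (flipSide (ρ f))) f eq
    ...   | inj₁ ρμρf≡f  = contradiction (trans (sym (ρ-invol _)) (cong ρ ρμρf≡f)) (flipSide≢ (ρ f))
    ...   | inj₂ ρμρf≡μf =
      contradiction (trans (cong ρ (sym ρμρf≡μf)) (ρ-invol _)) (ρ∘flipSide≢flipSide∘ρ 3≤deg)
    hexagon | there (here eq) with same-end (ρ (flipSide (ρ f))) (ρ f) eq
    ...   | inj₁ ρμρf≡ρf  = contradiction (cong endOf (ρ-injective ρμρf≡ρf)) (endOf-ρ≢ 2≤deg)
    ...   | inj₂ ρμρf≡μρf = contradiction ρμρf≡μρf (ρ-fpf _)
    hexagon | there (there (here eq)) with same-end (ρ (flipSide (ρ f))) (ρ (flipSide f)) eq
    ...   | inj₁ ρμρf≡ρμf  = contradiction (flipSide-injective (ρ-injective ρμρf≡ρμf)) (ρ-fpf f)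
    ...   | inj₂ ρμρf≡μρμf = ρμρf≡μρμf

  module _ (A : Fin k) where

    onCountry : Flag m → ℕ
    onCountry f = 𝟙 (F f ≟ᶠ A)

    sidesOn : End m → ℕ
    sidesOn p = onCountry (flagAt p) + onCountry (flipSide (flagAt p))

    sidesOn-endOf : ∀ f → sidesOn (endOf f) ≡ onCountry f + onCountry (flipSide f)
    sidesOn-endOf (e , i , false) = refl
    sidesOn-endOf (e , i , true)  = +-comm (onCountry (e , i , false)) (onCountry (e , i , true))

    sidesOn-end : ∀ e i → sidesOn (e , i) ≡ sidesOn (e , false)
    sidesOn-end e false = refl
    sidesOn-end e true  = cong₂ _+_ (cong (λ c → 𝟙 (c ≟ᶠ A)) (sym (F-λ (e , true , false))))
                                    (cong (λ c → 𝟙 (c ≟ᶠ A)) (sym (F-λ (e , true , true))))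

    sidesOn≤2 : ∀ p → sidesOn p ≤ 2
    sidesOn≤2 p = +-mono-≤ (𝟙≤1 (F (flagAt p) ≟ᶠ A)) (𝟙≤1 (F (flipSide (flagAt p)) ≟ᶠ A))

    fdeg≡∑sidesOn : fdeg F A ≡ ∑[ e < m ] sidesOn (e , false)
    fdeg≡∑sidesOn = length-filter-halfEdges (λ p → F (proj₁ p , false , proj₂ p) ≟ᶠ A)

    sidesOn-step : ∀ {f g} → Step ρ f g → vdeg V (V f) ≡ 2 → sidesOn (endOf g) ≡ sidesOn (endOf f)
    sidesOn-step (byλ (e , i , _)) _ = trans (sidesOn-end e (not i)) (sym (sidesOn-end e i))
    sidesOn-step (byμ _)           _ = refl
    sidesOn-step (byρ f)      deg≡2 = begin
      sidesOn (endOf (ρ f))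
        ≡⟨ sidesOn-endOf (ρ f) ⟩
      onCountry (ρ f) + onCountry (flipSide (ρ f))
        ≡⟨ cong (λ g → onCountry (ρ f) + onCountry g) (sym (proj₂ (degree-two deg≡2))) ⟩
      onCountry (ρ f) + onCountry (ρ (flipSide f))
        ≡⟨ cong₂ (λ c c′ → 𝟙 (c ≟ᶠ A) + 𝟙 (c′ ≟ᶠ A)) (F-ρ f) (F-ρ (flipSide f)) ⟩
      onCountry f + onCountry (flipSide f)
        ≡⟨ sidesOn-endOf f ⟨
      sidesOn (endOf f) ∎
      where open ≡-Reasoning

    sidesOn-degree-three : ∀ {f} → vdeg V (V f) ≡ 3 →
      map sidesOn (endOf f ∷ endOf (ρ f) ∷ endOf (ρ (flipSide f)) ∷ [])
        ≡ pairSums (onCountry f) (onCountry (flipSide f)) (onCountry (flipSide (ρ f)))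
    sidesOn-degree-three {f} deg≡3 = cong₂ _∷_ (sidesOn-endOf f) (cong₂ _∷_ y (cong (_∷ []) z))
      where
      y : sidesOn (endOf (ρ f)) ≡ onCountry f + onCountry (flipSide (ρ f))
      y = trans (sidesOn-endOf (ρ f)) (cong (λ c → 𝟙 (c ≟ᶠ A) + onCountry (flipSide (ρ f))) (F-ρ f))
      z : sidesOn (endOf (ρ (flipSide f))) ≡ onCountry (flipSide f) + onCountry (flipSide (ρ f))
      z = trans (sidesOn-endOf (ρ (flipSide f)))
                (cong₂ (λ c c′ → 𝟙 (c ≟ᶠ A) + 𝟙 (c′ ≟ᶠ A))
                       (F-ρ (flipSide f))
                       (trans (cong F (sym (proj₂ (degree-three deg≡3)))) (F-ρ (flipSide (ρ f)))))

    record Trivalent (w : Fin n) : Set where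
      field
        ends         : List (End m)
        ends-at      : EndsAt w ends
        b₁ b₂ b₃     : Bool
        sidesOn-ends : map sidesOn ends ≡ pairSums (bit b₁) (bit b₂) (bit b₃)

    trivalent : ∀ w → vdeg V w ≡ 3 → Trivalent w
    trivalent w deg≡3 with V-onto w
    ... | f , refl = record
      { ends         = endOf f ∷ endOf (ρ f) ∷ endOf (ρ (flipSide f)) ∷ []
      ; ends-at      = proj₁ (degree-three deg≡3)
      ; b₁           = does (F f ≟ᶠ A)
      ; b₂           = does (F (flipSide f) ≟ᶠ A)
      ; b₃           = does (F (flipSide (ρ f)) ≟ᶠ A)
      ; sidesOn-ends = sidesOn-degree-three deg≡3
      }

module TwoTrivalentVertices {m a k} {t : Vec ℕ k} (M : FlagMap m (2 + a) k (dSeq a) t) where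
  open FlagMap M
  open MapProperties M

  vdeg-suc-suc : ∀ j → vdeg V (suc (suc j)) ≡ 2
  vdeg-suc-suc j = trans (V-deg (suc (suc j))) (lookup-replicate j 2)

  edges≡a+3 : m ≡ a + 3
  edges≡a+3 = *-cancelʳ-≡ m (a + 3) 2 (begin
    m * 2                                          ≡⟨ handshake ⟨
    3 + (3 + ∑[ j < a ] lookup (replicate a 2) j)  ≡⟨ cong (λ s → 3 + (3 + s)) ∑-twos ⟩
    6 + a * 2                                      ≡⟨ +-comm 6 (a * 2) ⟩
    a * 2 + 3 * 2                                  ≡⟨ *-distribʳ-+ 2 a 3 ⟨
    (a + 3) * 2                                    ∎)
    where
    open ≡-Reasoning
    ∑-twos : ∑[ j < a ] lookup (replicate a 2) j ≡ a * 2
    ∑-twos = trans (sum-cong-≗ {a} (λ j → lookup-replicate j 2)) (sum-const a 2)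

  AtTrivalent : Flag m → Set
  AtTrivalent f = V f ≡ zero ⊎ V f ≡ suc zero

  trivalent-or-degree-two : ∀ f → AtTrivalent f ⊎ vdeg V (V f) ≡ 2
  trivalent-or-degree-two f with V f
  ... | zero        = inj₁ (inj₁ refl)
  ... | suc zero    = inj₁ (inj₂ refl)
  ... | suc (suc j) = inj₂ (vdeg-suc-suc j)

  count-trivalent-even : ∀ (g : End m → ℕ) → (∀ e → g (e , true) ≡ g (e , false)) →
                         (∀ f → vdeg V (V f) ≡ 2 → g (endOf (ρ f)) ≡ g (endOf f)) →
                         2 ∣ count zero g + count (suc zero) g
  count-trivalent-even g g-edge g-degree-two = ∣m+n∣m⇒∣n (subst (2 ∣_) split 2∣total) 2∣rest
    where
    open ≡-Reasoning
    c₀ = count zero g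
    c₁ = count (suc zero) g
    rest = ∑[ j < a ] count (suc (suc j)) g
    split : Σᴱ g ≡ rest + (c₀ + c₁)
    split = begin
      Σᴱ g               ≡⟨ ∑-count g ⟨
      c₀ + (c₁ + rest)   ≡⟨ +-assoc c₀ c₁ rest ⟨
      (c₀ + c₁) + rest   ≡⟨ +-comm (c₀ + c₁) rest ⟩
      rest + (c₀ + c₁)   ∎
    2∣total : 2 ∣ Σᴱ g
    2∣total = ∣-sum (λ e → subst (λ x → 2 ∣ g (e , false) + x) (sym (g-edge e)) (2∣n+n (g (e , false))))
    degree-two-even : ∀ w → vdeg V w ≡ 2 → 2 ∣ count w g
    degree-two-even w deg≡2 with V-onto w
    ... | f , refl = subst (2 ∣_) (sym count≡) (2∣n+n (g (endOf f)))
      where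
      count≡ : count (V f) g ≡ g (endOf f) + g (endOf f)
      count≡ = begin
        count (V f) g                        ≡⟨ count-EndsAt (proj₁ (degree-two deg≡2)) g ⟩
        g (endOf f) + (g (endOf (ρ f)) + 0)  ≡⟨ cong (g (endOf f) +_) (+-identityʳ _) ⟩
        g (endOf f) + g (endOf (ρ f))        ≡⟨ cong (g (endOf f) +_) (g-degree-two f deg≡2) ⟩
        g (endOf f) + g (endOf f)            ∎
    2∣rest : 2 ∣ rest
    2∣rest = ∣-sum (λ j → degree-two-even (suc (suc j)) (vdeg-suc-suc j))

  module _ (A : Fin k) where
    private
      U = trivalent A zero (V-deg zero)
      W = trivalent A (suc zero) (V-deg (suc zero))
      module U = Trivalent U
      module W = Trivalent W
      S = map (sidesOn A) U.ends
      T = map (sidesOn A) W.ends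

      sidesOn-∈-ends : ∀ {w xs} → EndsAt w xs → ∀ h → V h ≡ w → sidesOn A (endOf h) ∈ map (sidesOn A) xs
      sidesOn-∈-ends ends-at h h-at =
        ∈-map⁺ (sidesOn A) (EndsAt.covers ends-at (endOf h) (trans (vertex-endOf h) h-at))

      trivalent-or-sidesOn-invariant :
        ∀ f → AtTrivalent f ⊎ (∀ {g} → Step ρ f g → sidesOn A (endOf g) ≡ sidesOn A (endOf f))
      trivalent-or-sidesOn-invariant f =
        Sum.map₂ (λ deg≡2 step → sidesOn-step A step deg≡2) (trivalent-or-degree-two f)

      sidesOn-at-trivalent : ∀ e → sidesOn A (e , false) ∈ S ++ T
      sidesOn-at-trivalent e
        with first-hit AtTrivalent (sidesOn A ∘ endOf) trivalent-or-sidesOn-invariant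
                       (connected (e , false , false) (proj₁ (V-onto zero))) (inj₁ (proj₂ (V-onto zero)))
      ... | h , inj₁ h-at , eq = ∈-++⁺ˡ (subst (_∈ S) eq (sidesOn-∈-ends U.ends-at h h-at))
      ... | h , inj₂ h-at , eq = ∈-++⁺ʳ S (subst (_∈ T) eq (sidesOn-∈-ends W.ends-at h h-at))

      is-two : End m → ℕ
      is-two p = 𝟙 (sidesOn A p ≟ 2)

      twos-even : 2 ∣ twos S + twos T
      twos-even = subst (2 ∣_) (cong₂ _+_ (count≡twos U.ends-at) (count≡twos W.ends-at))
                    (count-trivalent-even is-two
                      (λ e → cong (λ x → 𝟙 (x ≟ 2)) (sidesOn-end A e true))
                      (λ f deg≡2 → cong (λ x → 𝟙 (x ≟ 2)) (sidesOn-step A (byρ f) deg≡2)))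
        where
        count≡twos : ∀ {w xs} → EndsAt w xs → count w is-two ≡ twos (map (sidesOn A) xs)
        count≡twos {xs = xs} ends-at = trans (count-EndsAt ends-at is-two) (cong sumˡ (map-∘ xs))

      U-parity : TwosParity S
      U-parity = subst TwosParity (sym U.sidesOn-ends) (twos-parity U.b₁ U.b₂ U.b₃)

      W-parity : TwosParity T
      W-parity = subst TwosParity (sym W.sidesOn-ends) (twos-parity W.b₁ W.b₂ W.b₃)

      all-one-at-U : (∀ e → sidesOn A (e , false) ≡ 1) → All (_≡ 1) S
      all-one-at-U all-one =
        map⁺ (All.universal (λ (e , i) → trans (sidesOn-end A e i) (all-one e)) U.ends)

    country-degree≢edges : fdeg F A ≢ m
    country-degree≢edges fdeg≡m
      with all-one-or-zero-and-two (λ e → sidesOn A (e , false)) (λ e → sidesOn≤2 A (e , false))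
                                   (trans (sym (fdeg≡∑sidesOn A)) fdeg≡m)
    ... | inj₁ all-one = pairSums-not-all-one (bit U.b₁) (bit U.b₂) (bit U.b₃)
                           (subst (All (_≡ 1)) U.sidesOn-ends (all-one-at-U all-one))
    ... | inj₂ ((e₀ , sides≡0) , (e₂ , sides≡2)) =
      zero-and-two-excluded U-parity W-parity twos-even
        (subst (_∈ S ++ T) sides≡0 (sidesOn-at-trivalent e₀))
        (subst (_∈ S ++ T) sides≡2 (sidesOn-at-trivalent e₂))

proposition6p4 : (a b : ℕ) → b < a + 3 → a + 3 ≤ 2 * b → ¬ Realizable (dSeq a) (tSeq a b)
proposition6p4 a b _ _ (inj₁ (() , _))
proposition6p4 a b _ _ (inj₂ (m , _ , M)) = country-degree≢edges zero (trans (F-deg zero) (sym edges≡a+3))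
  where
  open FlagMap M
  open TwoTrivalentVertices M
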